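{- Let $X$ be a metric space and $S$ a subset of $X$ such that $-(-S)\subset\lnot\lnot S$. Then $-(-S)=(\lnot\lnot S)^{\circ}$.
   Context: Work in Bishop-style constructive mathematics (intuitionistic logic). For a subset $S$ of a metric space $(X,\rho)$: a point $x$ is bounded away from $S$ if there is $r>0$ with $\rho(x,y)\ge r$ for all $y\in S$; the metric complement $-S$ is the set of points bounded away from $S$. The logical complement is $\lnot S=\{x\in X: \forall y\in S\ \lnot(x=y)\}$ and $\lnot\lnot S=\lnot(\lnot S)$. $A^{\circ}$ denotes the interior of $A$. -}

module Defs where

open import Data.Nat using (ℕ; suc; _*_)
open import Data.Integer using (+_)
open import Data.Rational using (ℚ; _/_; _+_; _-_; -_; ∣_∣; _≤_; _<_; 0ℚ)
open import Data.Product using (Σ; _×_; ∃)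
open import Relation.Nullary using (¬_)
open import Relation.Binary.Structures using (IsEquivalence)

-- Bishop's constructive real numbers (Bishop–Bridges, Ch. 2),
-- with sequences indexed from 0: index n stands for Bishop's n+1.

inv : ℕ → ℚ
inv n = + 1 / suc n

Seq : Set
Seq = ℕ → ℚ

-- Bishop sum / difference of sequences: (x+y)_k = x_{2k} + y_{2k}
-- (1-indexed); with 0-indexing, k = n+1 gives index 2n+1.
_⊕_ : Seq → Seq → Seq
(x ⊕ y) n = x (suc (2 * n)) + y (suc (2 * n))

_⊖_ : Seq → Seq → Seq
(x ⊖ y) n = x (suc (2 * n)) - y (suc (2 * n))

PosSeq : Seq → Set
PosSeq x = ∃ λ n → inv n < x n

NonNegSeq : Seq → Set
NonNegSeq x = ∀ n → - inv n ≤ x n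

record ℝ : Set where
  field
    seq : Seq
    reg : ∀ m n → ∣ seq m - seq n ∣ ≤ inv m + inv n
open ℝ public

_≃ˢ_ : Seq → Seq → Set
x ≃ˢ y = ∀ n → ∣ x n - y n ∣ ≤ inv n + inv n

_≃_ : ℝ → ℝ → Set
x ≃ y = seq x ≃ˢ seq y

zeroˢ : Seq
zeroˢ _ = 0ℚ

IsZero : ℝ → Set
IsZero x = seq x ≃ˢ zeroˢ

Positive : ℝ → Set
Positive x = PosSeq (seq x)

_≤ℝ_ : ℝ → ℝ → Set
x ≤ℝ y = NonNegSeq (seq y ⊖ seq x)

_<ℝ_ : ℝ → ℝ → Set
x <ℝ y = PosSeq (seq y ⊖ seq x)

_≤ℝ_+ℝ_ : ℝ → ℝ → ℝ → Set
x ≤ℝ y +ℝ z = NonNegSeq ((seq y ⊕ seq z) ⊖ seq x)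

record MetricSpace : Set₁ where
  field
    Carrier : Set
    _≈_     : Carrier → Carrier → Set
    isEquivalence : IsEquivalence _≈_
    ρ       : Carrier → Carrier → ℝ
    ρ-zero⇒≈ : ∀ x y → IsZero (ρ x y) → x ≈ y
    ≈⇒ρ-zero : ∀ x y → x ≈ y → IsZero (ρ x y)
    ρ-sym   : ∀ x y → ρ x y ≃ ρ y x
    ρ-tri   : ∀ x y z → ρ x z ≤ℝ ρ x y +ℝ ρ y z

module _ (M : MetricSpace) where
  open MetricSpace M

  Pred : Set₁
  Pred = Carrier → Set

  Extensional : Pred → Set
  Extensional S = ∀ {x y} → x ≈ y → S x → S y

  _⊆_ : Pred → Pred → Set
  A ⊆ B = ∀ x → A x → B x

  _≐_ : Pred → Pred → Set
  A ≐ B = (A ⊆ B) × (B ⊆ A)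

  BoundedAway : Carrier → Pred → Set
  BoundedAway x S = Σ ℝ λ r → Positive r × (∀ y → S y → r ≤ℝ ρ x y)

  metricCompl : Pred → Pred
  metricCompl S x = BoundedAway x S

  logicalCompl : Pred → Pred
  logicalCompl S x = ∀ y → S y → ¬ (x ≈ y)

  interior : Pred → Pred
  interior A x = Σ ℝ λ r → Positive r × (∀ y → ρ x y <ℝ r → A y)

-- -(-S) is open: if x is at distance ≥ r from -S and ρ(x,y) < r, the
-- triangle inequality keeps y at distance ≥ r - ρ(x,y) > 0 from -S, so the
-- hypothesis puts -(-S) inside (¬¬S)°. Conversely -S ⊆ ¬S, so a point w of -S
-- within distance r of a point whose r-ball lies in ¬¬S would be distinct from
-- itself; in Bishop's reals ¬ (ρ(x,w) < r) already gives r ≤ ρ(x,w).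
module Submission where

open import Data.Nat as ℕ using (ℕ; suc; zero)
open import Data.Integer as ℤ using (+_)
open import Data.Rational hiding (Positive)
open import Data.Rational.Properties
import Data.Rational.Unnormalised as U
import Data.Rational.Unnormalised.Properties as UP
import Data.Nat.Properties as ℕP
open import Data.List using (_∷_; [])
open import Data.Product using (∃; _,_)
open import Data.Sum using (inj₁; inj₂)
open import Data.Empty using (⊥)
open import Level using (0ℓ)
open import Relation.Nullary using (¬_)
open import Relation.Nullary.Decidable using (dec⇒maybe)
open import Relation.Binary.PropositionalEquality using (_≡_; _≢_; refl; sym; cong; subst; subst₂)
open import Relation.Binary.Structures using (IsEquivalence)
open import Tactic.RingSolver using (solve)
open import Tactic.RingSolver.Core.AlmostCommutativeRing
  using (AlmostCommutativeRing; fromCommutativeRing)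
open import Defs

-- The solver needs the zero test to cancel coefficients.
ℚ-ring : AlmostCommutativeRing 0ℓ 0ℓ
ℚ-ring = fromCommutativeRing +-*-commutativeRing (λ p → dec⇒maybe (0ℚ ≟ p))

p≤∣p∣ : ∀ p → p ≤ ∣ p ∣
p≤∣p∣ p with ≤-total p 0ℚ
... | inj₁ p≤0 = ≤-trans p≤0 (0≤∣p∣ p)
... | inj₂ 0≤p = ≤-reflexive (sym (0≤p⇒∣p∣≡p 0≤p))

p≤q⇒0≤q-p : ∀ {p q} → p ≤ q → 0ℚ ≤ q - p
p≤q⇒0≤q-p {p} {q} p≤q = subst (_≤ q - p) (+-inverseʳ p) (+-monoˡ-≤ (- p) p≤q)

p<q⇒0<q-p : ∀ {p q} → p < q → 0ℚ < q - p
p<q⇒0<q-p {p} {q} p<q = subst (_< q - p) (+-inverseʳ p) (+-monoˡ-< (- p) p<q)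

0≤q-p⇒p≤q : ∀ {p q} → 0ℚ ≤ q - p → p ≤ q
0≤q-p⇒p≤q {p} {q} 0≤q-p = subst₂ _≤_ (+-identityˡ p) q-p+p≡q (+-monoˡ-≤ p 0≤q-p)
  where
  q-p+p≡q : (q - p) + p ≡ q
  q-p+p≡q = solve (p ∷ q ∷ []) ℚ-ring

∣p∣≤q⇒0≤q-p : ∀ {p q} → ∣ p ∣ ≤ q → 0ℚ ≤ q - p
∣p∣≤q⇒0≤q-p {p} ∣p∣≤q = p≤q⇒0≤q-p (≤-trans (p≤∣p∣ p) ∣p∣≤q)

∣p∣≤q⇒0≤q+p : ∀ {p q} → ∣ p ∣ ≤ q → 0ℚ ≤ q + p
∣p∣≤q⇒0≤q+p {p} {q} ∣p∣≤q =
  subst (0ℚ ≤_) q--p≡q+p (∣p∣≤q⇒0≤q-p (subst (_≤ q) (sym (∣-p∣≡∣p∣ p)) ∣p∣≤q))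
  where
  q--p≡q+p : q - (- p) ≡ q + p
  q--p≡q+p = solve (p ∷ q ∷ []) ℚ-ring

0≤+ : ∀ {p q} → 0ℚ ≤ p → 0ℚ ≤ q → 0ℚ ≤ p + q
0≤+ {p} {q} 0≤p 0≤q = subst (_≤ p + q) (+-identityʳ 0ℚ) (+-mono-≤ 0≤p 0≤q)

0<+ : ∀ {p q} → 0ℚ < p → 0ℚ ≤ q → 0ℚ < p + q
0<+ {p} {q} 0<p 0≤q = subst (_< p + q) (+-identityʳ 0ℚ) (+-mono-<-≤ 0<p 0≤q)

-- Taking the inequality first lets the solver read the equation's left side.
0<-resp-≡ : ∀ {p q} → 0ℚ < p → p ≡ q → 0ℚ < q
0<-resp-≡ 0<p refl = 0<p

0<⇒≢0 : ∀ {p} → 0ℚ < p → p ≢ 0ℚ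
0<⇒≢0 0<p p≡0 = <-irrefl (sym p≡0) 0<p

-- x ⊕ y and x ⊖ y read x and y at index odd n.
odd : ℕ → ℕ
odd n = suc (2 ℕ.* n)

inv-pos : ∀ n → 0ℚ < inv n
inv-pos n = positive⁻¹ (inv n) {{normalize-pos 1 (suc n)}}

inv≃mkℚᵘ : ∀ n → toℚᵘ (inv n) U.≃ U.mkℚᵘ (+ 1) n
inv≃mkℚᵘ n = toℚᵘ-fromℚᵘ (U.mkℚᵘ (+ 1) n)

inv-odd-half : ∀ n → inv (odd n) + inv (odd n) ≡ inv n
inv-odd-half n = toℚᵘ-injective (begin
  toℚᵘ (inv (odd n) + inv (odd n))                 ≈⟨ toℚᵘ-homo-+ (inv (odd n)) (inv (odd n)) ⟩
  toℚᵘ (inv (odd n)) U.+ toℚᵘ (inv (odd n))        ≈⟨ UP.+-cong (inv≃mkℚᵘ (odd n)) (inv≃mkℚᵘ (odd n)) ⟩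
  U.mkℚᵘ (+ 1) (odd n) U.+ U.mkℚᵘ (+ 1) (odd n)    ≈⟨ U.*≡* (cong +_ (cross-multiplied n)) ⟩
  U.mkℚᵘ (+ 1) n                                   ≈⟨ UP.≃-sym (inv≃mkℚᵘ n) ⟩
  toℚᵘ (inv n)                                     ∎)
  where
  open UP.≃-Reasoning
  open import Data.Nat.Tactic.RingSolver using () renaming (solve-∀ to ℕ-solve-∀)
  cross-multiplied : ∀ n → (1 ℕ.* (2 ℕ.+ 2 ℕ.* n) ℕ.+ 1 ℕ.* (2 ℕ.+ 2 ℕ.* n)) ℕ.* (1 ℕ.+ n)
                         ≡ 1 ℕ.* ((2 ℕ.+ 2 ℕ.* n) ℕ.* (2 ℕ.+ 2 ℕ.* n))
  cross-multiplied = ℕ-solve-∀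

inv-odd< : ∀ n → inv (odd n) < inv n
inv-odd< n = subst₂ _<_ (+-identityˡ (inv (odd n))) (inv-odd-half n)
  (+-monoˡ-< (inv (odd n)) (inv-pos (odd n)))

inv-archimedean : ∀ {ε} → 0ℚ < ε → ∃ λ n → inv n < ε
inv-archimedean {mkℚ (+ suc k) d _} _ =
  suc d , toℚᵘ-cancel-< (UP.<-respˡ-≃ (UP.≃-sym (inv≃mkℚᵘ (suc d))) (U.*<* (ℤ.+<+ cross-multiplied)))
  where
  cross-multiplied : 1 ℕ.* suc d ℕ.< suc k ℕ.* suc (suc d)
  cross-multiplied = ℕP.≤-trans (ℕP.≤-reflexive (cong suc (ℕP.*-identityˡ (suc d))))
                                (ℕP.m≤n*m (suc (suc d)) (suc k))
inv-archimedean {mkℚ (+ zero) _ _} (*<* (ℤ.+<+ ()))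
inv-archimedean {mkℚ ℤ.-[1+ _ ] _ _} (*<* ())

fromℚ : ℚ → ℝ
fromℚ q = record
  { seq = λ _ → q
  ; reg = λ m n → subst (_≤ inv m + inv n) (cong ∣_∣ (sym (+-inverseʳ q)))
                        (0≤+ (<⇒≤ (inv-pos m)) (<⇒≤ (inv-pos n)))
  }

fromℚ-inv-positive : ∀ n → Positive (fromℚ (inv n))
fromℚ-inv-positive n = odd n , inv-odd< n

≮⇒≥ℝ : ∀ x y → ¬ (y <ℝ x) → x ≤ℝ y
≮⇒≥ℝ x y y≮x n = subst (- inv n ≤_) (-[p-q]≡q-p (seq x (odd n)) (seq y (odd n)))
  (neg-antimono-≤ (≮⇒≥ λ lt → y≮x (n , lt)))
  where
  -[p-q]≡q-p : ∀ p q → - (p - q) ≡ q - p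
  -[p-q]≡q-p p q = solve (p ∷ q ∷ []) ℚ-ring

positive≤⇒≄0 : ∀ s t → Positive s → s ≤ℝ t → ¬ IsZero t
positive≤⇒≄0 s t (N , sN>invN) s≤t t≃0 with inv-archimedean (p<q⇒0<q-p sN>invN)
... | m , invm<gap =
  contradiction (seq s N) (inv N) (seq s k) (seq t k) (inv k)
    (inv-odd-half n) (inv-odd-half (odd m)) (inv-odd-half m) (inv-pos k)
    invm<gap (reg s N k) (s≤t n) (t≃0 k)
  where
  n = odd (odd m)
  k = odd n
  -- Here, as below, a positive combination of the hypotheses sums to 0.
  contradiction : ∀ sN δN sk tk ε {ε₂ ε₄ ε₈}
    → ε + ε ≡ ε₂ → ε₂ + ε₂ ≡ ε₄ → ε₄ + ε₄ ≡ ε₈ → 0ℚ < ε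
    → ε₈ < sN - δN → ∣ sN - sk ∣ ≤ δN + ε → - ε₂ ≤ tk - sk → ∣ tk - 0ℚ ∣ ≤ ε + ε → ⊥
  contradiction sN δN sk tk ε refl refl refl ε>0 h₁ h₂ h₃ h₄ = 0<⇒≢0
    (0<+ (p<q⇒0<q-p h₁) (0≤+ (∣p∣≤q⇒0≤q-p h₂) (0≤+ (p≤q⇒0≤q-p h₃)
      (0≤+ (∣p∣≤q⇒0≤q-p h₄) (0≤+ ε≥0 (0≤+ ε≥0 ε≥0))))))
    (solve (sN ∷ δN ∷ sk ∷ tk ∷ ε ∷ []) ℚ-ring)
    where ε≥0 = <⇒≤ ε>0

fromℚ≤-by-term : ∀ q (x : ℝ) k → q + inv k ≤ seq x k → fromℚ q ≤ℝ x
fromℚ≤-by-term q x k q+invk≤xₖ = ≮⇒≥ℝ (fromℚ q) x λ { (P , x<q) →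
  contradiction (seq x (odd P)) (seq x k) (inv (odd P)) (inv k)
    (inv-odd-half P) (inv-pos (odd P)) x<q (reg x (odd P) k) q+invk≤xₖ }
  where
  contradiction : ∀ xP xk δ ε {δ₂}
    → δ + δ ≡ δ₂ → 0ℚ < δ → δ₂ < q - xP → ∣ xP - xk ∣ ≤ δ + ε → q + ε ≤ xk → ⊥
  contradiction xP xk δ ε refl δ>0 h₁ h₂ h₃ = 0<⇒≢0
    (0<+ (p<q⇒0<q-p h₁) (0≤+ (∣p∣≤q⇒0≤q+p h₂) (0≤+ (p≤q⇒0≤q-p h₃) (<⇒≤ δ>0))))
    (solve (q ∷ δ ∷ xP ∷ xk ∷ ε ∷ []) ℚ-ring)

<ℝ⇒uniform-gap : ∀ a r → a <ℝ r
  → ∃ λ j → ∀ b c → r ≤ℝ c → c ≤ℝ a +ℝ b → fromℚ (inv j) ≤ℝ b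
<ℝ⇒uniform-gap a r (M , r-a>invM) with inv-archimedean (p<q⇒0<q-p r-a>invM)
... | m , invm<gap = j , λ b c r≤c c≤a+b → fromℚ≤-by-term (inv j) b k
  (lower-bound (seq r (odd M)) (seq a (odd M)) (seq r (odd j)) (seq c (odd j)) (seq a k) (seq b k)
    (inv (odd M)) (inv k) (inv-odd-half M) (inv-odd-half (odd j)) (inv-odd-half j) (inv-odd-half (odd m))
    (inv-odd-half m) invm<gap (r≤c j) (c≤a+b j) (reg r (odd M) (odd j)) (reg a (odd M) k))
  where
  j = odd (odd m)
  k = odd (odd j)
  lower-bound : ∀ rM aM rj cj ak bk δ ε {δ₂ ε₂ ε₄ ε₈ ε₁₆}
    → δ + δ ≡ δ₂ → ε + ε ≡ ε₂ → ε₂ + ε₂ ≡ ε₄ → ε₄ + ε₄ ≡ ε₈ → ε₈ + ε₈ ≡ ε₁₆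
    → ε₁₆ < (rM - aM) - δ₂ → - ε₄ ≤ cj - rj → - ε₄ ≤ (ak + bk) - cj
    → ∣ rM - rj ∣ ≤ δ + ε₂ → ∣ aM - ak ∣ ≤ δ + ε → ε₄ + ε ≤ bk
  lower-bound rM aM rj cj ak bk δ ε refl refl refl refl refl h₁ h₂ h₃ h₄ h₅ =
    0≤q-p⇒p≤q (<⇒≤ (0<-resp-≡
      (0<+ (p<q⇒0<q-p h₁) (0≤+ (p≤q⇒0≤q-p h₂) (0≤+ (p≤q⇒0≤q-p h₃)
        (0≤+ (∣p∣≤q⇒0≤q-p h₄) (∣p∣≤q⇒0≤q+p h₅)))))
      (solve (rM ∷ aM ∷ rj ∷ cj ∷ ak ∷ bk ∷ δ ∷ ε ∷ []) ℚ-ring)))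

module _ (M : MetricSpace) where
  open MetricSpace M

  metricCompl⊆logicalCompl : ∀ S → _⊆_ M (metricCompl M S) (logicalCompl M S)
  metricCompl⊆logicalCompl S x (r , r>0 , r≤ρ) y y∈S x≈y =
    positive≤⇒≄0 r (ρ x y) r>0 (r≤ρ y y∈S) (≈⇒ρ-zero x y x≈y)

  metricCompl-open : ∀ T → _⊆_ M (metricCompl M T) (interior M (metricCompl M T))
  metricCompl-open T x (r , r>0 , r≤ρx) = r , r>0 , λ y ρxy<r →
    let j , gap = <ℝ⇒uniform-gap (ρ x y) r ρxy<r
    in fromℚ (inv j) , fromℚ-inv-positive j ,
       λ w w∈T → gap (ρ y w) (ρ x w) (r≤ρx w w∈T) (ρ-tri x y w)

  interior-mono : ∀ {A B} → _⊆_ M A B → _⊆_ M (interior M A) (interior M B)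
  interior-mono A⊆B x (r , r>0 , ball⊆A) = r , r>0 , λ y ρxy<r → A⊆B y (ball⊆A y ρxy<r)

  interior-¬¬⊆metricCompl² : ∀ S
    → _⊆_ M (interior M (logicalCompl M (logicalCompl M S))) (metricCompl M (metricCompl M S))
  interior-¬¬⊆metricCompl² S x (r , r>0 , ball⊆¬¬S) = r , r>0 , λ w w∈−S →
    ≮⇒≥ℝ r (ρ x w) λ ρxw<r →
      ball⊆¬¬S w ρxw<r w (metricCompl⊆logicalCompl S w w∈−S) (IsEquivalence.refl isEquivalence)

lemma3 : (M : MetricSpace) (S : Pred M) → Extensional M S
       → _⊆_ M (metricCompl M (metricCompl M S)) (logicalCompl M (logicalCompl M S))
       → _≐_ M (metricCompl M (metricCompl M S)) (interior M (logicalCompl M (logicalCompl M S)))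
lemma3 M S _ −−S⊆¬¬S =
  (λ x x∈−−S → interior-mono M −−S⊆¬¬S x (metricCompl-open M (metricCompl M S) x x∈−−S)) ,
  interior-¬¬⊆metricCompl² M S
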